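{- Let $k\geq 3$, let $n\geq 4$ be even, and let $[a_0,a_1,\dots,a_{n-1}]$ be a negasymmetric circuit in $\mathcal{C}_k(n-1)$ of odd period. Then $[a_0,a_1,\dots,a_{n-1}]$ contains precisely one negasymmetric $(n-1)$-tuple.
   Context: Tuples are $k$-ary (entries in $\mathbb{Z}_k$), negation is modulo $k$, $\mathbf{u}^R$ is the reverse of $\mathbf{u}$; a tuple $\mathbf{u}$ is negasymmetric if $\mathbf{u}=-\mathbf{u}^R$. The pseudoweight of $a\in\mathbb{Z}_k$ is $a$ if $a\ne0$ and $k/2$ if $a=0$, and of a tuple the sum over its entries. $B_k(n-1)$ is the de Bruijn digraph with vertices the $k$-ary $(n-1)$-tuples and edges the $k$-ary $n$-tuples $(a_0,\dots,a_{n-1})$ from $(a_0,\dots,a_{n-2})$ to $(a_1,\dots,a_{n-1})$; $H_k(n-1)$ is its subgraph of edges of pseudoweight exactly $kn/2$. For an $n$-tuple $(a_0,\dots,a_{n-1})$, with $p$ the least positive $c$ such that $a_i=a_{(i+c)\bmod n}$ for all $i$, $[a_0,\dots,a_{n-1}]$ is the circuit whose edges are the cyclic shifts $(a_j,\dots,a_{j+n-1})$ (indices mod $n$); $p$ is its period. The $(n-1)$-tuples contained in the circuit are its vertices, i.e. the tuples $(a_j,a_{j+1},\dots,a_{j+n-2})$ (indices mod $n$). $\mathcal{C}_k(n-1)$ is the set of such circuits arising from edges of $H_k(n-1)$. A circuit is negasymmetric if it contains edges $\mathbf a,\mathbf b$ (not necessarily distinct) with $\mathbf a=-\mathbf b^R$.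 -}

module Defs where

open import Data.Nat using (ℕ; zero; suc; _+_; _*_; _∸_)
open import Data.Nat.DivMod using (_mod_)
open import Data.Fin using (Fin; toℕ) renaming (zero to fzero; suc to fsuc)
open import Data.Vec using (Vec; []; tabulate; lookup; map; reverse; sum)
open import Data.Product using (Σ; ∃; _×_)
open import Relation.Binary.PropositionalEquality using (_≡_)

neg : ∀ {k} → Fin k → Fin k
neg {suc k} i = (suc k ∸ toℕ i) mod (suc k)

-- TWICE the pseudoweight of an entry: 2a if a ≠ 0, k if a = 0.
pw2 : ∀ {k} → Fin k → ℕ
pw2 {k} fzero = k
pw2 (fsuc i) = 2 * suc (toℕ i)

pseudoweight2 : ∀ {k m} → Vec (Fin k) m → ℕ
pseudoweight2 v = sum (map pw2 v)

Negasymmetric : ∀ {k m} → Vec (Fin k) m → Set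
Negasymmetric u = u ≡ map neg (reverse u)

-- An edge of H_k(n-1): an n-tuple of pseudoweight exactly kn/2
-- (equivalently, twice the pseudoweight equals k*n).
InH : ∀ {k n} → Vec (Fin k) n → Set
InH {k} {n} a = pseudoweight2 a ≡ k * n

shift : ∀ {A : Set} {n} → ℕ → Vec A n → Vec A n
shift {n = zero} c a = []
shift {n = suc m} c a = tabulate (λ (i : Fin (suc m)) → lookup a ((toℕ i + c) mod suc m))

vertexAt : ∀ {A : Set} {n} → ℕ → Vec A n → Vec A (n ∸ 1)
vertexAt {n = zero} c a = []
vertexAt {n = suc m} c a = tabulate (λ (i : Fin m) → lookup a ((toℕ i + c) mod suc m))

EdgeOf : ∀ {A : Set} {n} → Vec A n → Vec A n → Set
EdgeOf a e = ∃ λ j → e ≡ shift j a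

VertexOf : ∀ {A : Set} {n} → Vec A n → Vec A (n ∸ 1) → Set
VertexOf a v = ∃ λ j → v ≡ vertexAt j a

IsPeriod : ∀ {A : Set} {n} → Vec A n → ℕ → Set
IsPeriod a p = (0 Data.Nat.< p) × (shift p a ≡ a)
             × (∀ c → 0 Data.Nat.< c → c Data.Nat.< p → ¬ (shift c a ≡ a))
  where open import Relation.Nullary using (¬_)

NegasymmetricCircuit : ∀ {k n} → Vec (Fin k) n → Set
NegasymmetricCircuit a = Σ _ λ e → Σ _ λ f →
  EdgeOf a e × EdgeOf a f × (e ≡ map neg (reverse f))

-- Read the circuit as the sequence A s = a_(s mod n), whose least period is p.
-- A negasymmetric pair of edges makes A antisymmetric, A x = −A y, under a
-- reflection x + y ≡ c (mod p), and the vertex starting at m is negasymmetric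
-- exactly when A is antisymmetric under the reflection with c ≡ n − 2 + 2m.
-- Since p is odd and n even, p ≤ n − 1, so the windows involved meet every
-- residue mod p and these local mirror conditions hold globally.  Two such
-- reflections compose to the translation by the difference of their centres,
-- which by minimality of p is ≡ 0; so the centre is unique mod p.  As p is odd,
-- 2m ≡ c − (n − 2) then determines m mod p, and with it the vertex.
module Submission where

open import Defs
open import Data.Nat using (ℕ; _≤_; _∸_)
open import Data.Nat.Divisibility using (_∣_)
open import Data.Fin using (Fin)
open import Data.Vec using (Vec)
open import Data.Product using (Σ; _×_)
open import Relation.Nullary using (¬_)
open import Relation.Binary.PropositionalEquality using (_≡_)

open import Data.Nat using (zero; suc; pred; _+_; _*_; _<_; _%_; _/_; NonZero; >-nonZero; >-nonZero⁻¹; z<s; s≤s; s≤s⁻¹)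
open import Data.Nat.Properties
open import Data.Nat.DivMod hiding (_mod_)
open import Data.Nat.Divisibility using (m%n≡0⇒n∣m)
open import Data.Nat.Tactic.RingSolver using (solve-∀)
open import Data.Fin using (toℕ; fromℕ; fromℕ<; inject₁; opposite) renaming (zero to fzero; suc to fsuc)
open import Data.Fin.Properties using (toℕ-injective; toℕ-fromℕ<; toℕ<n; opposite-prop; opposite-involutive)
open import Data.Vec using ([]; _∷_; _∷ʳ_; lookup; tabulate; map; reverse)
open import Data.Vec.Properties using (lookup∘tabulate; tabulate∘lookup; tabulate-cong; tabulate-∘; reverse-∷)
open import Data.Product using (∃; _,_; proj₁; proj₂)
open import Function using (_∘_)
open import Function.Bundles using (_⇔_; mk⇔; Equivalence)
open import Level using (0ℓ)
open import Relation.Binary.Bundles using (Setoid)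
import Relation.Binary.Reasoning.Setoid as SetoidReasoning
open import Relation.Nullary using (contradiction)
open import Relation.Binary.PropositionalEquality using (refl; sym; trans; cong; cong₂; subst; module ≡-Reasoning)

open Equivalence using (to; from)

private
  variable
    A B : Set
    n : ℕ

lookup-∷ʳ-fromℕ : (xs : Vec A n) (x : A) → lookup (xs ∷ʳ x) (fromℕ n) ≡ x
lookup-∷ʳ-fromℕ []       x = refl
lookup-∷ʳ-fromℕ (_ ∷ xs) x = lookup-∷ʳ-fromℕ xs x

lookup-∷ʳ-inject₁ : (xs : Vec A n) (x : A) (i : Fin n) → lookup (xs ∷ʳ x) (inject₁ i) ≡ lookup xs i
lookup-∷ʳ-inject₁ (_ ∷ xs) x fzero    = refl
lookup-∷ʳ-inject₁ (_ ∷ xs) x (fsuc i) = lookup-∷ʳ-inject₁ xs x i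

lookup-reverse-opposite : (xs : Vec A n) (i : Fin n) → lookup (reverse xs) (opposite i) ≡ lookup xs i
lookup-reverse-opposite (x ∷ xs) fzero rewrite reverse-∷ x xs = lookup-∷ʳ-fromℕ (reverse xs) x
lookup-reverse-opposite (x ∷ xs) (fsuc i) rewrite reverse-∷ x xs =
  trans (lookup-∷ʳ-inject₁ (reverse xs) x (opposite i)) (lookup-reverse-opposite xs i)

reverse-tabulate : (h : Fin n → A) → reverse (tabulate h) ≡ tabulate (h ∘ opposite)
reverse-tabulate h = trans (sym (tabulate∘lookup _)) (tabulate-cong lookup-reverse-tabulate)
  where
  open ≡-Reasoning
  lookup-reverse-tabulate : ∀ i → lookup (reverse (tabulate h)) i ≡ h (opposite i)
  lookup-reverse-tabulate i = begin
    lookup rev i                       ≡⟨ cong (lookup rev) (opposite-involutive i) ⟨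
    lookup rev (opposite (opposite i)) ≡⟨ lookup-reverse-opposite (tabulate h) (opposite i) ⟩
    lookup (tabulate h) (opposite i)   ≡⟨ lookup∘tabulate h (opposite i) ⟩
    h (opposite i)                     ∎
    where rev = reverse (tabulate h)

tabulate≡map-reverse-tabulate⇔ : (f : A → B) (g : Fin n → B) (h : Fin n → A) →
  tabulate g ≡ map f (reverse (tabulate h)) ⇔ (∀ i → g i ≡ f (h (opposite i)))
tabulate≡map-reverse-tabulate⇔ f g h = mk⇔ pointwise (λ g≗ → trans (tabulate-cong g≗) (sym rhs≡))
  where
  open ≡-Reasoning
  rhs≡ : map f (reverse (tabulate h)) ≡ tabulate (f ∘ h ∘ opposite)
  rhs≡ = trans (cong (map f) (reverse-tabulate h)) (sym (tabulate-∘ f (h ∘ opposite)))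
  pointwise : tabulate g ≡ map f (reverse (tabulate h)) → ∀ i → g i ≡ f (h (opposite i))
  pointwise eq i = begin
    g i                                    ≡⟨ lookup∘tabulate g i ⟨
    lookup (tabulate g) i                  ≡⟨ cong (λ v → lookup v i) (trans eq rhs≡) ⟩
    lookup (tabulate (f ∘ h ∘ opposite)) i ≡⟨ lookup∘tabulate _ i ⟩
    f (h (opposite i))                     ∎

suc-toℕ+toℕ-opposite : (t : Fin n) → suc (toℕ t + toℕ (opposite t)) ≡ n
suc-toℕ+toℕ-opposite t = trans (cong (λ u → suc (toℕ t + u)) (opposite-prop t)) (m+[n∸m]≡n (toℕ<n t))

-- A record rather than a synonym for x % p ≡ y % p, so that unification sees
-- the congruence and not the reducts of _%_.
infix 4 _≡_mod_
record _≡_mod_ (x y p : ℕ) .{{_ : NonZero p}} : Set where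
  constructor ≡-mod
  field %≡% : x % p ≡ y % p

module _ {p : ℕ} .{{_ : NonZero p}} where

  mod-refl : ∀ {x} → x ≡ x mod p
  mod-refl = ≡-mod refl

  mod-sym : ∀ {x y} → x ≡ y mod p → y ≡ x mod p
  mod-sym (≡-mod eq) = ≡-mod (sym eq)

  mod-trans : ∀ {x y z} → x ≡ y mod p → y ≡ z mod p → x ≡ z mod p
  mod-trans (≡-mod eq) (≡-mod eq') = ≡-mod (trans eq eq')

  mod-setoid : Setoid 0ℓ 0ℓ
  mod-setoid = record
    { Carrier       = ℕ
    ; _≈_           = _≡_mod p
    ; isEquivalence = record { refl = mod-refl ; sym = mod-sym ; trans = mod-trans }
    }

module mod-Reasoning (p : ℕ) .{{_ : NonZero p}} = SetoidReasoning (mod-setoid {p})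

module _ {p : ℕ} .{{_ : NonZero p}} where

  ≡⇒mod : ∀ {x y} → x ≡ y → x ≡ y mod p
  ≡⇒mod refl = mod-refl

  +-cong-mod : ∀ {x y u v} → x ≡ y mod p → u ≡ v mod p → x + u ≡ y + v mod p
  +-cong-mod {x} {y} {u} {v} (≡-mod x≡y) (≡-mod u≡v) = ≡-mod (begin
    (x + u) % p         ≡⟨ %-distribˡ-+ x u p ⟩
    (x % p + u % p) % p ≡⟨ cong₂ (λ a b → (a + b) % p) x≡y u≡v ⟩
    (y % p + v % p) % p ≡⟨ %-distribˡ-+ y v p ⟨
    (y + v) % p         ∎)
    where open ≡-Reasoning

  suc-cong-mod : ∀ {x y} → x ≡ y mod p → suc x ≡ suc y mod p
  suc-cong-mod = +-cong-mod {1} {1} mod-refl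

  *-congˡ-mod : ∀ c {x y} → x ≡ y mod p → c * x ≡ c * y mod p
  *-congˡ-mod c {x} {y} (≡-mod x≡y) = ≡-mod (begin
    (c * x) % p           ≡⟨ %-distribˡ-* c x p ⟩
    (c % p * (x % p)) % p ≡⟨ cong (λ b → (c % p * b) % p) x≡y ⟩
    (c % p * (y % p)) % p ≡⟨ %-distribˡ-* c y p ⟨
    (c * y) % p           ∎)
    where open ≡-Reasoning

  %-mod : ∀ x → x % p ≡ x mod p
  %-mod x = ≡-mod (m%n%n≡m%n x p)

  +-*-mod : ∀ x q → x + q * p ≡ x mod p
  +-*-mod x q = ≡-mod ([m+kn]%n≡m%n x q p)

  mod-<⇒≡ : ∀ {x y} → x < p → y < p → x ≡ y mod p → x ≡ y
  mod-<⇒≡ x<p y<p (≡-mod eq) = trans (sym (m<n⇒m%n≡m x<p)) (trans eq (m<n⇒m%n≡m y<p))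

  difference-mod : ∀ x y → ∃ λ d → y + d ≡ x mod p
  difference-mod x y = x + pred p * y , (begin
    y + (x + pred p * y)  ≡⟨ rearrange x y (pred p) ⟩
    x + y * suc (pred p)  ≡⟨ cong (λ q → x + y * q) (suc-pred p) ⟩
    x + y * p             ≈⟨ +-*-mod x y ⟩
    x                     ∎)
    where
    open mod-Reasoning p
    rearrange : ∀ x y q → y + (x + q * y) ≡ x + y * suc q
    rearrange = solve-∀

  +-cancelˡ-mod : ∀ x {b d} → x + b ≡ x + d mod p → b ≡ d mod p
  +-cancelˡ-mod x {b} {d} eq = begin
    b              ≈⟨ +-cong-mod (mod-sym x+x'≡0) mod-refl ⟩
    (x + x') + b   ≡⟨ swap b ⟩
    x' + (x + b)   ≈⟨ +-cong-mod {x'} mod-refl eq ⟩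
    x' + (x + d)   ≡⟨ swap d ⟨
    (x + x') + d   ≈⟨ +-cong-mod x+x'≡0 mod-refl ⟩
    d              ∎
    where
    open mod-Reasoning p
    x' = proj₁ (difference-mod 0 x)
    x+x'≡0 = proj₂ (difference-mod 0 x)
    swap : ∀ z → (x + x') + z ≡ x' + (x + z)
    swap z = trans (cong (_+ z) (+-comm x x')) (+-assoc x' x z)

  representative-mod : ∀ {L} → p ≤ L → ∀ i x → Σ (Fin L) λ t → toℕ t + i ≡ x mod p
  representative-mod p≤L i x = t , (begin
    toℕ t + i   ≡⟨ cong (_+ i) (toℕ-fromℕ< d%p<L) ⟩
    d % p + i   ≈⟨ +-cong-mod (%-mod d) mod-refl ⟩
    d + i       ≡⟨ +-comm d i ⟩
    i + d       ≈⟨ proj₂ (difference-mod x i) ⟩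
    x           ∎)
    where
    open mod-Reasoning p
    d = proj₁ (difference-mod x i)
    d%p<L = <-≤-trans (m%n<n d p) p≤L
    t = fromℕ< d%p<L

odd⇒suc[/2*2] : ∀ {p} → ¬ 2 ∣ p → p ≡ suc (p / 2 * 2)
odd⇒suc[/2*2] {p} p-odd with p % 2 | m≡m%n+[m/n]*n p 2 | m%n≡0⇒n∣m p 2 | m%n<n p 2
... | 0           | _  | 2∣p | _ = contradiction (2∣p refl) p-odd
... | 1           | eq | _   | _ = eq
... | suc (suc _) | _  | _   | s≤s (s≤s ())

module _ {p : ℕ} .{{_ : NonZero p}} (p-odd : ¬ 2 ∣ p) where

  private
    half : ℕ
    half = suc (p / 2)

    half-inverse : ∀ x → half * (x + x) ≡ x mod p
    half-inverse x = begin
      half * (x + x)            ≡⟨ expand (p / 2) x ⟩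
      x + x * suc (p / 2 * 2)   ≡⟨ cong (λ q → x + x * q) (odd⇒suc[/2*2] p-odd) ⟨
      x + x * p                 ≈⟨ +-*-mod x x ⟩
      x                         ∎
      where
      open mod-Reasoning p
      expand : ∀ q x → suc q * (x + x) ≡ x + x * suc (q * 2)
      expand = solve-∀

  halve-mod-odd : ∀ c → ∃ λ m → m + m ≡ c mod p
  halve-mod-odd c = half * c , mod-trans (≡⇒mod (sym (*-distribˡ-+ half c c))) (half-inverse c)

  double-injective-mod-odd : ∀ {x y} → x + x ≡ y + y mod p → x ≡ y mod p
  double-injective-mod-odd {x} {y} eq =
    mod-trans (mod-sym (half-inverse x)) (mod-trans (*-congˡ-mod half eq) (half-inverse y))

module _ {X : Set} {p : ℕ} .{{_ : NonZero p}} {A : ℕ → X} (periodic : ∀ s → A (s + p) ≡ A s) where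

  periodic-+-* : ∀ s q → A (s + q * p) ≡ A s
  periodic-+-* s zero    = cong A (+-identityʳ s)
  periodic-+-* s (suc q) = begin
    A (s + (p + q * p)) ≡⟨ cong A (trans (cong (s +_) (+-comm p (q * p))) (sym (+-assoc s (q * p) p))) ⟩
    A (s + q * p + p)   ≡⟨ periodic (s + q * p) ⟩
    A (s + q * p)       ≡⟨ periodic-+-* s q ⟩
    A s                 ∎
    where open ≡-Reasoning

  periodic-% : ∀ x → A (x % p) ≡ A x
  periodic-% x = trans (sym (periodic-+-* (x % p) (x / p))) (cong A (sym (m≡m%n+[m/n]*n x p)))

  periodic-cong : ∀ {x y} → x ≡ y mod p → A x ≡ A y
  periodic-cong {x} {y} (≡-mod eq) = trans (sym (periodic-% x)) (trans (cong A eq) (periodic-% y))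

module NegatedReflections {X : Set} (neg : X → X) (A : ℕ → X) where

  NegReverseWindows : (i j L : ℕ) → Set
  NegReverseWindows i j L = ∀ (t : Fin L) → A (toℕ t + i) ≡ neg (A (toℕ (opposite t) + j))

  -- The offset in suc (x + y) gives windows of length L at i and j the centre L + i + j.
  NegSymmetricAbout : (p : ℕ) .{{_ : NonZero p}} → ℕ → Set
  NegSymmetricAbout p c = ∀ x y → suc (x + y) ≡ c mod p → A x ≡ neg (A y)

  private
    window-centre : ∀ {L} (t : Fin L) i j → suc (toℕ t + i + (toℕ (opposite t) + j)) ≡ L + i + j
    window-centre t i j = trans (rearrange (toℕ t) (toℕ (opposite t)) i j)
                                (cong (λ L → L + i + j) (suc-toℕ+toℕ-opposite t))
      where
      rearrange : ∀ t u i j → suc (t + i + (u + j)) ≡ suc (t + u) + i + j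
      rearrange = solve-∀

  module _ {p : ℕ} .{{_ : NonZero p}} where

    negSymmetricAbout-cong : ∀ {c c'} → c ≡ c' mod p → NegSymmetricAbout p c → NegSymmetricAbout p c'
    negSymmetricAbout-cong c≡c' σ x y xy≡c' = σ x y (mod-trans xy≡c' (mod-sym c≡c'))

    negSymmetricAbout⇒negReverseWindows : ∀ {i j L} →
      NegSymmetricAbout p (L + i + j) → NegReverseWindows i j L
    negSymmetricAbout⇒negReverseWindows {i} {j} σ t =
      σ (toℕ t + i) (toℕ (opposite t) + j) (≡⇒mod (window-centre t i j))

    private
      mirror-index : ∀ {L i j x y} (t : Fin L) → toℕ t + i ≡ x mod p →
        suc (x + y) ≡ L + i + j mod p → toℕ (opposite t) + j ≡ y mod p
      mirror-index {L} {i} {j} {x} {y} t t+i≡x xy≡c = +-cancelˡ-mod (suc x) (begin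
        suc (x + (toℕ (opposite t) + j))          ≈⟨ suc-cong-mod (+-cong-mod (mod-sym t+i≡x) mod-refl) ⟩
        suc (toℕ t + i + (toℕ (opposite t) + j))  ≡⟨ window-centre t i j ⟩
        L + i + j                                 ≈⟨ xy≡c ⟨
        suc (x + y)                               ∎)
        where open mod-Reasoning p

    module _ (periodic : ∀ s → A (s + p) ≡ A s) where

      -- A window of length at least p meets every residue class, so its mirror
      -- relation extends to all of ℕ.
      negReverseWindows⇒negSymmetricAbout : ∀ {i j L} → p ≤ L →
        NegReverseWindows i j L → NegSymmetricAbout p (L + i + j)
      negReverseWindows⇒negSymmetricAbout {i} {j} p≤L w x y xy≡c = begin
        A x                              ≡⟨ periodic-cong periodic t+i≡x ⟨
        A (toℕ t + i)                    ≡⟨ w t ⟩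
        neg (A (toℕ (opposite t) + j))   ≡⟨ cong neg (periodic-cong periodic (mirror-index t t+i≡x xy≡c)) ⟩
        neg (A y)                        ∎
        where
        open ≡-Reasoning
        t = proj₁ (representative-mod p≤L i x)
        t+i≡x = proj₂ (representative-mod p≤L i x)

      module _ (neg-involutive : ∀ x → neg (neg x) ≡ x) where

        negSymmetricAbout-translation : ∀ {c c' d} → NegSymmetricAbout p c → NegSymmetricAbout p c' →
          c' + d ≡ c mod p → ∀ s → A (s + d) ≡ A s
        negSymmetricAbout-translation {c} {c'} {d} σ σ' c'+d≡c s = begin
          A (s + d)             ≡⟨ neg-involutive _ ⟨
          neg (neg (A (s + d))) ≡⟨ cong neg (σ y (s + d) y+[s+d]≡c) ⟨
          neg (A y)             ≡⟨ σ' s y s+y≡c' ⟨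
          A s                   ∎
          where
          open ≡-Reasoning
          y = proj₁ (difference-mod c' (suc s))
          s+y≡c' = proj₂ (difference-mod c' (suc s))
          rearrange : ∀ y s d → suc (y + (s + d)) ≡ suc (s + y) + d
          rearrange = solve-∀
          y+[s+d]≡c : suc (y + (s + d)) ≡ c mod p
          y+[s+d]≡c = mod-trans (≡⇒mod (rearrange y s d)) (mod-trans (+-cong-mod s+y≡c' mod-refl) c'+d≡c)

        negSymmetricAbout-unique : (∀ d → (∀ s → A (s + d) ≡ A s) → d ≡ 0 mod p) →
          ∀ {c c'} → NegSymmetricAbout p c → NegSymmetricAbout p c' → c ≡ c' mod p
        negSymmetricAbout-unique least {c} {c'} σ σ' = begin
          c        ≈⟨ c'+d≡c ⟨
          c' + d   ≈⟨ +-cong-mod mod-refl (least d (negSymmetricAbout-translation σ σ' c'+d≡c)) ⟩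
          c' + 0   ≡⟨ +-identityʳ c' ⟩
          c'       ∎
          where
          open mod-Reasoning p
          d = proj₁ (difference-mod c c')
          c'+d≡c = proj₂ (difference-mod c c')

neg-inverse : ∀ {k} (x : Fin (suc k)) → toℕ x + toℕ (neg x) ≡ 0 mod suc k
neg-inverse {k} x = begin
  toℕ x + toℕ (neg x)                ≡⟨ cong (toℕ x +_) (toℕ-fromℕ< _) ⟩
  toℕ x + (suc k ∸ toℕ x) % suc k    ≈⟨ +-cong-mod {x = toℕ x} mod-refl (%-mod (suc k ∸ toℕ x)) ⟩
  toℕ x + (suc k ∸ toℕ x)            ≡⟨ m+[n∸m]≡n (<⇒≤ (toℕ<n x)) ⟩
  suc k                              ≈⟨ ≡-mod (n%n≡0 (suc k)) ⟩
  0                                  ∎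
  where open mod-Reasoning (suc k)

neg-involutive : ∀ {k} (x : Fin (suc k)) → neg (neg x) ≡ x
neg-involutive {k} x = toℕ-injective (mod-<⇒≡ (toℕ<n _) (toℕ<n x) (+-cancelˡ-mod (toℕ (neg x)) both-inverse))
  where
  open mod-Reasoning (suc k)
  both-inverse : toℕ (neg x) + toℕ (neg (neg x)) ≡ toℕ (neg x) + toℕ x mod suc k
  both-inverse = begin
    toℕ (neg x) + toℕ (neg (neg x)) ≈⟨ neg-inverse (neg x) ⟩
    0                               ≈⟨ neg-inverse x ⟨
    toℕ x + toℕ (neg x)             ≡⟨ +-comm (toℕ x) (toℕ (neg x)) ⟩
    toℕ (neg x) + toℕ x             ∎

module _ {X : Set} {N' : ℕ} (a : Vec X (suc N')) where

  cyclic : ℕ → X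
  cyclic s = lookup a (fromℕ< (m%n<n s (suc N')))

  cyclic-cong : ∀ {x y} → x ≡ y mod suc N' → cyclic x ≡ cyclic y
  cyclic-cong (≡-mod eq) =
    cong (lookup a) (toℕ-injective (trans (toℕ-fromℕ< _) (trans eq (sym (toℕ-fromℕ< _)))))

  lookup≡cyclic-toℕ : ∀ i → lookup a i ≡ cyclic (toℕ i)
  lookup≡cyclic-toℕ i =
    cong (lookup a) (toℕ-injective (sym (trans (toℕ-fromℕ< _) (m<n⇒m%n≡m (toℕ<n i)))))

  shift≡⇔invariant : ∀ {c} → shift c a ≡ a ⇔ (∀ s → cyclic (s + c) ≡ cyclic s)
  shift≡⇔invariant {c} = mk⇔ invariant shift≡
    where
    open ≡-Reasoning
    invariant : shift c a ≡ a → ∀ s → cyclic (s + c) ≡ cyclic s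
    invariant eq s = begin
      cyclic (s + c)          ≡⟨ cyclic-cong {s + c} (+-cong-mod (mod-sym (%-mod s)) mod-refl) ⟩
      cyclic (s % suc N' + c) ≡⟨ cong (λ r → cyclic (r + c)) (toℕ-fromℕ< (m%n<n s (suc N'))) ⟨
      cyclic (toℕ r + c)      ≡⟨ lookup∘tabulate (λ t → cyclic (toℕ t + c)) r ⟨
      lookup (shift c a) r    ≡⟨ cong (λ v → lookup v r) eq ⟩
      cyclic s                ∎
      where
      r = fromℕ< (m%n<n s (suc N'))
    shift≡ : (∀ s → cyclic (s + c) ≡ cyclic s) → shift c a ≡ a
    shift≡ inv =
      trans (tabulate-cong (λ i → trans (inv (toℕ i)) (sym (lookup≡cyclic-toℕ i)))) (tabulate∘lookup a)

  shift-length : shift (suc N') a ≡ a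
  shift-length =
    from shift≡⇔invariant (λ s → cyclic-cong {s + suc N'} {s} (≡-mod ([m+n]%n≡m%n s (suc N'))))

  module _ {p : ℕ} .{{_ : NonZero p}} (period : IsPeriod a p) where

    period≤length : p ≤ suc N'
    period≤length = ≮⇒≥ (λ N<p → proj₂ (proj₂ period) (suc N') z<s N<p shift-length)

    cyclic-periodic : ∀ s → cyclic (s + p) ≡ cyclic s
    cyclic-periodic = to shift≡⇔invariant (proj₁ (proj₂ period))

    shift-below-period : ∀ {c} → c < p → shift c a ≡ a → c ≡ 0
    shift-below-period {zero}  _   _  = refl
    shift-below-period {suc c} c<p sh = contradiction sh (proj₂ (proj₂ period) (suc c) z<s c<p)

    invariant⇒≡0-mod-period : ∀ d → (∀ s → cyclic (s + d) ≡ cyclic s) → d ≡ 0 mod p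
    invariant⇒≡0-mod-period d inv =
      ≡-mod (trans (shift-below-period (m%n<n d p) (from shift≡⇔invariant inv%))
                   (sym (m<n⇒m%n≡m (>-nonZero⁻¹ p))))
      where
      inv% : ∀ s → cyclic (s + d % p) ≡ cyclic s
      inv% s = trans (periodic-cong cyclic-periodic (+-cong-mod {x = s} mod-refl (%-mod d))) (inv s)

    vertexAt-cong : ∀ {m m'} → m ≡ m' mod p → vertexAt m a ≡ vertexAt m' a
    vertexAt-cong m≡m' =
      tabulate-cong (λ t → periodic-cong cyclic-periodic (+-cong-mod {x = toℕ t} mod-refl m≡m'))

module _ {k N' : ℕ} (a : Vec (Fin (suc k)) (suc N')) {p : ℕ} .{{_ : NonZero p}} (period : IsPeriod a p) where

  open NegatedReflections neg (cyclic a)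

  private
    window : ∀ {L} → ℕ → Fin L → Fin (suc k)
    window c t = cyclic a (toℕ t + c)

  odd-period<even-length : ¬ 2 ∣ p → 2 ∣ suc N' → p < suc N'
  odd-period<even-length p-odd 2∣n =
    ≤∧≢⇒< (period≤length a period) (λ p≡n → p-odd (subst (2 ∣_) (sym p≡n) 2∣n))

  negasymmetric-edges⇒negSymmetricAbout : ∀ {i j} →
    shift i a ≡ map neg (reverse (shift j a)) → NegSymmetricAbout p (suc N' + i + j)
  negasymmetric-edges⇒negSymmetricAbout {i} {j} =
    negReverseWindows⇒negSymmetricAbout (cyclic-periodic a period) (period≤length a period)
    ∘ to (tabulate≡map-reverse-tabulate⇔ neg (window i) (window j))

  negasymmetric-vertexAt⇔ : p ≤ N' → ∀ {m} →
    Negasymmetric (vertexAt m a) ⇔ NegSymmetricAbout p (N' + (m + m))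
  negasymmetric-vertexAt⇔ p≤N' {m} = mk⇔
    (negSymmetricAbout-cong reassoc ∘ negReverseWindows⇒negSymmetricAbout (cyclic-periodic a period) p≤N'
      ∘ to (tabulate≡map-reverse-tabulate⇔ neg (window m) (window m)))
    (from (tabulate≡map-reverse-tabulate⇔ neg (window m) (window m))
      ∘ negSymmetricAbout⇒negReverseWindows ∘ negSymmetricAbout-cong (mod-sym reassoc))
    where
    reassoc : N' + m + m ≡ N' + (m + m) mod p
    reassoc = ≡⇒mod (+-assoc N' m m)

lemma4p9 : (k n : ℕ) → 3 ≤ k → 4 ≤ n → 2 ∣ n →
    (a : Vec (Fin k) n) → InH a → NegasymmetricCircuit a →
    (p : ℕ) → IsPeriod a p → ¬ (2 ∣ p) →
    Σ (Vec (Fin k) (n ∸ 1)) λ v → (VertexOf a v × Negasymmetric v) ×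
    ((w : Vec (Fin k) (n ∸ 1)) → VertexOf a w → Negasymmetric w → w ≡ v)
lemma4p9 zero    _        () _ _ _ _ _ _ _ _
lemma4p9 (suc k) zero     _ () _ _ _ _ _ _ _
lemma4p9 (suc k) (suc N') _ _ 2∣n a _ (_ , _ , (i , refl) , (j , refl) , edges) p period p-odd =
  vertexAt m₀ a , ((m₀ , refl) , from vertex-centre centre₀) ,
  λ { w (m , refl) w-neg → vertexAt-cong a period (double-injective-mod-odd p-odd
        (+-cancelˡ-mod N' (unique (to vertex-centre w-neg) centre₀))) }
  where
  instance
    p-nonZero : NonZero p
    p-nonZero = >-nonZero (proj₁ period)

  open NegatedReflections neg (cyclic a)

  vertex-centre : ∀ {m} → Negasymmetric (vertexAt m a) ⇔ NegSymmetricAbout p (N' + (m + m))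
  vertex-centre = negasymmetric-vertexAt⇔ a period (s≤s⁻¹ (odd-period<even-length a period p-odd 2∣n))

  unique : ∀ {c c'} → NegSymmetricAbout p c → NegSymmetricAbout p c' → c ≡ c' mod p
  unique = negSymmetricAbout-unique (cyclic-periodic a period) neg-involutive
    (invariant⇒≡0-mod-period a period)

  m₀ : ℕ
  m₀ = proj₁ (halve-mod-odd p-odd (suc (i + j)))

  centre₀ : NegSymmetricAbout p (N' + (m₀ + m₀))
  centre₀ = negSymmetricAbout-cong
    (mod-trans (≡⇒mod (trans (cong suc (+-assoc N' i j)) (sym (+-suc N' (i + j)))))
               (+-cong-mod mod-refl (mod-sym (proj₂ (halve-mod-odd p-odd (suc (i + j)))))))
    (negasymmetric-edges⇒negSymmetricAbout a period edges)
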